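{- Let $G$ be a connected graph of order $n \ge 2$ such that either $n \le 4$, or $G$ contains a Hamiltonian path and $|E(G)| \ge 2(n-2)$. Then $Z(G) \le Z(L(G))$.
   Context: All graphs are finite, simple and undirected. $L(G)$ is the line graph of $G$. Zero forcing: each vertex of a graph $H$ is colored black or white; if a black vertex $u$ has exactly one white neighbor $w$, then $w$ becomes black (color-change rule). $S \subseteq V(H)$ is a zero forcing set if, starting with exactly $S$ black, repeated application of the rule makes every vertex black. $Z(H)$ is the minimum size of a zero forcing set of $H$. -}

module Defs where

open import Data.Empty using (⊥)
open import Data.Bool using (Bool; true; false; _∧_; _∨_; not; T)
open import Data.Bool.Properties using (∧-comm; ∨-comm)
open import Data.Nat using (ℕ; suc; _<ᵇ_; _≡ᵇ_; _≤_)
open import Data.Fin using (Fin; toℕ)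
open import Data.Fin.Subset using (Subset; _∈_; ∣_∣)
open import Data.List using (List; []; _∷_; length; filterᵇ; concatMap; map; lookup)
open import Data.List.Relation.Unary.Unique.Propositional using (Unique)
open import Data.List.Relation.Unary.Linked using (Linked)
open import Data.Vec using (allFin)
import Data.Vec as Vec
open import Data.Product using (_×_; _,_; proj₁; proj₂; ∃; Σ)
open import Relation.Binary.PropositionalEquality using (_≡_; refl; cong; cong₂)

record Graph (n : ℕ) : Set where
  field
    adj     : Fin n → Fin n → Bool
    adj-sym : ∀ u v → adj u v ≡ adj v u
    irrefl  : ∀ v → adj v v ≡ false
open Graph public

Adj : ∀ {n} → Graph n → Fin n → Fin n → Set
Adj G u v = T (adj G u v)

data Walk {n} (G : Graph n) : Fin n → Fin n → Set where
  here : ∀ {v} → Walk G v v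
  step : ∀ {u v w} → Adj G u v → Walk G v w → Walk G u w

Connected : ∀ {n} → Graph n → Set
Connected G = ∀ u v → Walk G u v

-- A Hamiltonian path: a list of distinct vertices of length n (hence
-- containing every vertex exactly once) with consecutive vertices adjacent.
HamiltonianPath : ∀ {n} → Graph n → Set
HamiltonianPath {n} G =
  Σ (List (Fin n)) λ p → (length p ≡ n) × Unique p × Linked (Adj G) p

allVertices : ∀ n → List (Fin n)
allVertices n = Vec.toList (allFin n)

edges : ∀ {n} → Graph n → List (Fin n × Fin n)
edges {n} G =
  filterᵇ (λ e → (toℕ (proj₁ e) <ᵇ toℕ (proj₂ e)) ∧ adj G (proj₁ e) (proj₂ e))
    (concatMap (λ u → map (λ v → (u , v)) (allVertices n)) (allVertices n))

numEdges : ∀ {n} → Graph n → ℕ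
numEdges G = length (edges G)

share : ∀ {n} → Fin n × Fin n → Fin n × Fin n → Bool
share (a , b) (c , d) =
  ((toℕ a ≡ᵇ toℕ c) ∨ (toℕ a ≡ᵇ toℕ d)) ∨ ((toℕ b ≡ᵇ toℕ c) ∨ (toℕ b ≡ᵇ toℕ d))

private
  ≡ᵇ-sym : ∀ m k → (m ≡ᵇ k) ≡ (k ≡ᵇ m)
  ≡ᵇ-sym ℕ.zero ℕ.zero = refl
  ≡ᵇ-sym ℕ.zero (suc k) = refl
  ≡ᵇ-sym (suc m) ℕ.zero = refl
  ≡ᵇ-sym (suc m) (suc k) = ≡ᵇ-sym m k

  ≡ᵇ-refl : ∀ m → (m ≡ᵇ m) ≡ true
  ≡ᵇ-refl ℕ.zero = refl
  ≡ᵇ-refl (suc m) = ≡ᵇ-refl m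

-- Line graph L(G): vertices are the edges of G (indexed by Fin (numEdges G)),
-- two distinct edges adjacent iff they share an endpoint.
lineAdj : ∀ {n} (G : Graph n) → Fin (numEdges G) → Fin (numEdges G) → Bool
lineAdj G i j =
  not (toℕ i ≡ᵇ toℕ j) ∧ (share (lookup (edges G) i) (lookup (edges G) j)
                          ∨ share (lookup (edges G) j) (lookup (edges G) i))

LineGraph : ∀ {n} (G : Graph n) → Graph (numEdges G)
LineGraph G = record
  { adj = lineAdj G
  ; adj-sym = λ i j → cong₂ _∧_ (cong not (≡ᵇ-sym (toℕ i) (toℕ j)))
                         (∨-comm (share (lookup (edges G) i) (lookup (edges G) j)) _)
  ; irrefl = λ i → cong (λ b → not b ∧ (share (lookup (edges G) i) (lookup (edges G) i) ∨ share (lookup (edges G) i) (lookup (edges G) i))) (≡ᵇ-refl (toℕ i))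
  }

-- Zero forcing: the set of vertices that eventually become black when
-- starting from S black and repeatedly applying the color-change rule
-- (a black vertex u with exactly one white neighbour w forces w).
data Black {n} (H : Graph n) (S : Subset n) : Fin n → Set where
  initial : ∀ {v} → v ∈ S → Black H S v
  force   : ∀ {u w} → Black H S u → Adj H u w →
            (∀ x → Adj H u x → (x ≡ w → ⊥) → Black H S x) →
            Black H S w

ZeroForcingSet : ∀ {n} → Graph n → Subset n → Set
ZeroForcingSet H S = ∀ v → Black H S v

IsZeroForcingNumber : ∀ {n} → Graph n → ℕ → Set
IsZeroForcingNumber {n} H k =
  (Σ (Subset n) λ S → ZeroForcingSet H S × ∣ S ∣ ≡ k)
  × (∀ S → ZeroForcingSet H S → k ≤ ∣ S ∣)

module Submission where

-- Write m = |E(G)|.  Follow a chronological list of forces in L(G) and call a vertex of G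
-- unsaturated while some edge at it is white.  When e forces f through their common endpoint p,
-- every other edge at p is already black, so p becomes saturated: the potential
-- (black edges) + (unsaturated vertices) never increases.  Initially the far endpoint of the first
-- forcing edge is saturated, and just before the last force both ends of the last edge are not;
-- hence Z(L(G)) ≥ m − n + 2.  On the other side Z(G) ≤ n − 1 for connected G, and Z(G) ≤ n − 2
-- when G has an induced path x – u – y (take all vertices but x and u: y forces u, then u forces
-- x).  A complete graph has m ≥ 2n − 3, and otherwise the hypothesis m ≥ 2(n − 2) closes the gap.  For n ≤ 4 and G not complete, Z(G) ≤ 2, so only
-- Z(L(G)) = 1 remains: then the forcing edge has an endpoint q of degree one, and {q} forces G,
-- because a force e → f through p in L(G) translates into p forcing the far end of f.

open import Defs
open import Data.Bool using (Bool; true; false; T; not; _∧_; _∨_)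
open import Data.Bool.Properties using (T?; T-∧; T-∨)
open import Data.Empty using (⊥-elim)
open import Data.Fin as Fin using (Fin; toℕ; zero; suc)
import Data.Fin.Properties as Finₚ
open import Data.Fin.Subset using (Subset; ⁅_⁆; _∪_; ∁; ∣_∣; _⊆_; _⊂_; _⊃_; _∈_; _∉_; ⊤; Nonempty)
open import Data.Fin.Subset.Induction using (⊃-wellFounded; Acc; acc)
open import Data.Fin.Subset.Properties
  using ( _∈?_; x∈⁅x⁆; x∈⁅y⁆⇒x≡y; x≢y⇒x∉⁅y⁆; x∉p⇒x∈∁p; x∈p∪q⁺; x∈p∪q⁻; p⊆p∪q; ⊆⊤; ⊆-antisym
        ; ∪-identityʳ; ∈⊤; p⊆q⇒∣p∣≤∣q∣; p⊂q⇒∣p∣<∣q∣; ∣∁p∣≡n∸∣p∣; ∣⁅x⁆∣≡1; ∣⊤∣≡n )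
open import Data.List as List using (List; []; _∷_; lookup; cartesianProduct; concatMap; map; _++_)
open import Data.List.Membership.Propositional using () renaming (_∈_ to _∈ₗ_)
import Data.List.Membership.Propositional.Properties as ∈ₗ
import Data.List.Relation.Unary.All as All
open import Data.List.Relation.Unary.AllPairs using (_∷_)
import Data.List.Relation.Unary.Any as Any
import Data.List.Relation.Unary.Any.Properties as Anyₚ
open import Data.List.Relation.Unary.Unique.Propositional using (Unique)
import Data.List.Relation.Unary.Unique.Propositional.Properties as Uniqueₚ
open import Data.Nat as ℕ using (ℕ; _≤_; _<_; _+_; _*_; _∸_; _<ᵇ_; _≡ᵇ_; s≤s; z≤n)
import Data.Nat.Properties as ℕₚ
open import Data.Product using (_×_; _,_; proj₁; proj₂; ∃; ∃₂)
open import Data.Sum as Sum using (_⊎_; inj₁; inj₂; [_,_]′)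
open import Data.Vec using (_∷_)
import Data.Vec as Vec
import Data.Vec.Properties as Vecₚ
open import Function using (_∘_)
open import Function.Bundles using (Equivalence; Injection)
open import Function.Definitions using (Injective)
open import Function.Properties.Inverse using (↔⇒↣)
open import Relation.Binary.Definitions using (tri<; tri≈; tri>)
open import Relation.Binary.PropositionalEquality using (_≡_; _≢_; refl; sym; trans; cong; subst)
open import Relation.Nullary using (¬_; Dec; yes; no)
open import Relation.Nullary.Decidable
  using (does; dec-true; decidable-stable; _×-dec_; _⊎-dec_; ¬?)
open import Relation.Unary using (Pred; Decidable)

open Equivalence using (to; from)

toList∘tabulate : ∀ {a} {A : Set a} {k} (f : Fin k → A) →
  Vec.toList (Vec.tabulate f) ≡ List.tabulate f
toList∘tabulate {k = ℕ.zero} f = refl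
toList∘tabulate {k = ℕ.suc k} f = cong (f zero ∷_) (toList∘tabulate (f ∘ suc))

lookup-injective : ∀ {a} {A : Set a} {xs : List A} → Unique xs →
  ∀ i j → lookup xs i ≡ lookup xs j → i ≡ j
lookup-injective (_ ∷ _) zero zero _ = refl
lookup-injective (x∉xs ∷ _) zero (suc j) eq = ⊥-elim (All.lookup x∉xs (∈ₗ.∈-lookup j) eq)
lookup-injective (x∉xs ∷ _) (suc i) zero eq = ⊥-elim (All.lookup x∉xs (∈ₗ.∈-lookup i) (sym eq))
lookup-injective (_ ∷ u) (suc i) (suc j) eq = cong suc (lookup-injective u i j eq)

concatMap-pairs≡cartesianProduct : ∀ {a b} {A : Set a} {B : Set b} (xs : List A) (ys : List B) →
  concatMap (λ x → map (x ,_) ys) xs ≡ cartesianProduct xs ys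
concatMap-pairs≡cartesianProduct []       ys = refl
concatMap-pairs≡cartesianProduct (x ∷ xs) ys =
  cong (map (x ,_) ys ++_) (concatMap-pairs≡cartesianProduct xs ys)

≢⇒T-not-≡ᵇ : ∀ {k} {u w : Fin k} → u ≢ w → T (not (toℕ u ≡ᵇ toℕ w))
≢⇒T-not-≡ᵇ {u = u} {w} u≢w with toℕ u ≡ᵇ toℕ w in eq
... | true  = u≢w (Finₚ.toℕ-injective (ℕₚ.≡ᵇ⇒≡ _ _ (subst T (sym eq) _)))
... | false = _

T-not-≡ᵇ⇒≢ : ∀ {k} {u w : Fin k} → T (not (toℕ u ≡ᵇ toℕ w)) → u ≢ w
T-not-≡ᵇ⇒≢ {u = u} t refl with toℕ u ≡ᵇ toℕ u | ℕₚ.≡⇒≡ᵇ (toℕ u) (toℕ u) refl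
T-not-≡ᵇ⇒≢ () refl | true  | _
T-not-≡ᵇ⇒≢ t  refl | false | ()

module _ {n : ℕ} where

  subsetOf : ∀ {ℓ} {P : Pred (Fin n) ℓ} → Decidable P → Subset n
  subsetOf P? = Vec.tabulate (does ∘ P?)

  ∈-subsetOf⁺ : ∀ {ℓ} {P : Pred (Fin n) ℓ} (P? : Decidable P) {x} → P x → x ∈ subsetOf P?
  ∈-subsetOf⁺ P? {x} px =
    Vecₚ.lookup⇒[]= x _ (trans (Vecₚ.lookup∘tabulate (does ∘ P?) x) (dec-true (P? x) px))

  ∈-subsetOf⁻ : ∀ {ℓ} {P : Pred (Fin n) ℓ} (P? : Decidable P) {x} → x ∈ subsetOf P? → P x
  ∈-subsetOf⁻ P? {x} x∈
    with P? x | trans (sym (Vecₚ.[]=⇒lookup x∈)) (Vecₚ.lookup∘tabulate (does ∘ P?) x)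
  ... | yes px | _ = px
  ... | no _   | ()

  ∈⁅⁆⇒⊆ : ∀ {x} {p : Subset n} → x ∈ p → ⁅ x ⁆ ⊆ p
  ∈⁅⁆⇒⊆ {x} x∈p y∈⁅x⁆ = subst (_∈ _) (sym (x∈⁅y⁆⇒x≡y x y∈⁅x⁆)) x∈p

  two-elements⇒2≤∣p∣ : ∀ {x y} {p : Subset n} → x ∈ p → y ∈ p → x ≢ y → 2 ≤ ∣ p ∣
  two-elements⇒2≤∣p∣ {x} {y} x∈p y∈p x≢y = subst (λ c → ℕ.suc c ≤ _) (∣⁅x⁆∣≡1 x)
    (p⊂q⇒∣p∣<∣q∣ (∈⁅⁆⇒⊆ x∈p , y , y∈p , λ y∈⁅x⁆ → x≢y (sym (x∈⁅y⁆⇒x≡y x y∈⁅x⁆))))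

  full⇒n≤∣p∣ : {p : Subset n} → (∀ x → x ∈ p) → n ≤ ∣ p ∣
  full⇒n≤∣p∣ {p} full = subst (_≤ ∣ p ∣) (∣⊤∣≡n n) (p⊆q⇒∣p∣≤∣q∣ {p = ⊤} (λ {x} _ → full x))

  p⊂p∪⁅x⁆ : ∀ {x} {p : Subset n} → x ∉ p → p ⊂ p ∪ ⁅ x ⁆
  p⊂p∪⁅x⁆ {x} x∉p = p⊆p∪q ⁅ x ⁆ , x , x∈p∪q⁺ (inj₂ (x∈⁅x⁆ x)) , x∉p

  ∣p∣≤1⇒p≡⁅x⁆ : ∀ {x} {p : Subset n} → x ∈ p → ∣ p ∣ ≤ 1 → p ≡ ⁅ x ⁆
  ∣p∣≤1⇒p≡⁅x⁆ {x} {p} x∈p ∣p∣≤1 = ⊆-antisym p⊆⁅x⁆ (∈⁅⁆⇒⊆ x∈p)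
    where
    p⊆⁅x⁆ : p ⊆ ⁅ x ⁆
    p⊆⁅x⁆ {y} y∈p with y Finₚ.≟ x
    ... | yes refl = x∈⁅x⁆ x
    ... | no  y≢x  =
      ⊥-elim (ℕₚ.<-irrefl refl (ℕₚ.≤-trans (two-elements⇒2≤∣p∣ y∈p x∈p y≢x) ∣p∣≤1))

∣p∪⁅x⁆∣≤1+∣p∣ : ∀ {n} (p : Subset n) x → ∣ p ∪ ⁅ x ⁆ ∣ ≤ ℕ.suc ∣ p ∣
∣p∪⁅x⁆∣≤1+∣p∣ (true ∷ p) zero rewrite ∪-identityʳ p = ℕₚ.n≤1+n _
∣p∪⁅x⁆∣≤1+∣p∣ (false ∷ p) zero rewrite ∪-identityʳ p = ℕₚ.≤-refl
∣p∪⁅x⁆∣≤1+∣p∣ (true ∷ p) (suc x) = s≤s (∣p∪⁅x⁆∣≤1+∣p∣ p x)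
∣p∪⁅x⁆∣≤1+∣p∣ (false ∷ p) (suc x) = ∣p∪⁅x⁆∣≤1+∣p∣ p x

module _ {n : ℕ} (G : Graph n) where

  Adj-sym : ∀ {u v} → Adj G u v → Adj G v u
  Adj-sym {u} {v} = subst T (adj-sym G u v)

  Adj⇒≢ : ∀ {u v} → Adj G u v → u ≢ v
  Adj⇒≢ {u} u~u refl = subst T (irrefl G u) u~u

  Adj? : ∀ u v → Dec (Adj G u v)
  Adj? u v = T? (adj G u v)

  walk⇒neighbour : ∀ {u v} → Walk G u v → u ≢ v → ∃ (Adj G u)
  walk⇒neighbour here          u≢u = ⊥-elim (u≢u refl)
  walk⇒neighbour (step u~w _) _   = _ , u~w

  connected⇒neighbour : Connected G → 2 ≤ n → ∀ v → ∃ (Adj G v)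
  connected⇒neighbour conn (s≤s (s≤s _)) zero    = walk⇒neighbour (conn zero (suc zero)) λ ()
  connected⇒neighbour conn (s≤s (s≤s _)) (suc v) = walk⇒neighbour (conn (suc v) zero) λ ()

record InducedPath₃ {n : ℕ} (G : Graph n) : Set where
  field
    x u y : Fin n
    x~u   : Adj G x u
    u~y   : Adj G u y
    x≢y   : x ≢ y
    x≁y   : ¬ Adj G x y

module _ {n : ℕ} (G : Graph n) where

  walk⇒inducedPath₃ : ∀ {a b} → Walk G a b → a ≢ b → ¬ Adj G a b → InducedPath₃ G
  walk⇒inducedPath₃ here a≢a _ = ⊥-elim (a≢a refl)
  walk⇒inducedPath₃ {a} {b} (step {v = v} a~v walk) a≢b a≁b with Adj? G v b
  ... | yes v~b = record { x~u = a~v ; u~y = v~b ; x≢y = a≢b ; x≁y = a≁b }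
  ... | no  v≁b = walk⇒inducedPath₃ walk (λ { refl → a≁b a~v }) v≁b

  complete⊎inducedPath₃ : Connected G → (∀ a b → a ≢ b → Adj G a b) ⊎ InducedPath₃ G
  complete⊎inducedPath₃ conn
    with Finₚ.any? (λ a → Finₚ.any? (λ b → ¬? (a Finₚ.≟ b) ×-dec ¬? (Adj? G a b)))
  ... | yes (a , b , a≢b , a≁b) = inj₂ (walk⇒inducedPath₃ (conn a b) a≢b a≁b)
  ... | no noMissingEdge = inj₁ λ a b a≢b →
    decidable-stable (Adj? G a b) (λ a≁b → noMissingEdge (a , b , a≢b , a≁b))

  ∁-initial : ∀ {p : Subset n} {v} → v ∉ p → Black G (∁ p) v
  ∁-initial = initial ∘ x∉p⇒x∈∁p

  ∁⁅w⁆-zeroForcing : ∀ {u w} → Adj G w u → ZeroForcingSet G (∁ ⁅ w ⁆)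
  ∁⁅w⁆-zeroForcing {u} {w} w~u v with v Finₚ.≟ w
  ... | no v≢w   = ∁-initial (x≢y⇒x∉⁅y⁆ v≢w)
  ... | yes refl = force (∁-initial (x≢y⇒x∉⁅y⁆ (Adj⇒≢ G w~u ∘ sym))) (Adj-sym G w~u)
                         (λ _ _ → ∁-initial ∘ x≢y⇒x∉⁅y⁆)

  module _ (P : InducedPath₃ G) where
    open InducedPath₃ P

    private
      outside : ∀ {v} → v ≢ x → v ≢ u → Black G (∁ (⁅ x ⁆ ∪ ⁅ u ⁆)) v
      outside v≢x v≢u = ∁-initial λ v∈ →
        [ v≢x ∘ x∈⁅y⁆⇒x≡y x , v≢u ∘ x∈⁅y⁆⇒x≡y u ]′ (x∈p∪q⁻ ⁅ x ⁆ ⁅ u ⁆ v∈)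

      black-u : Black G (∁ (⁅ x ⁆ ∪ ⁅ u ⁆)) u
      black-u = force (outside (x≢y ∘ sym) (Adj⇒≢ G u~y ∘ sym)) (Adj-sym G u~y)
        λ v y~v v≢u → outside (λ { refl → x≁y (Adj-sym G y~v) }) v≢u

      black-x : Black G (∁ (⁅ x ⁆ ∪ ⁅ u ⁆)) x
      black-x = force black-u (Adj-sym G x~u) λ v u~v v≢x → outside v≢x (Adj⇒≢ G u~v ∘ sym)

    ∁⁅x,u⁆-zeroForcing : ZeroForcingSet G (∁ (⁅ x ⁆ ∪ ⁅ u ⁆))
    ∁⁅x,u⁆-zeroForcing v with v Finₚ.≟ x | v Finₚ.≟ u
    ... | yes refl | _        = black-x
    ... | no  _    | yes refl = black-u
    ... | no  v≢x  | no  v≢u  = outside v≢x v≢u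

    zeroForcingNumber≤n∸2 : ∀ {z} → IsZeroForcingNumber G z → z ≤ n ∸ 2
    zeroForcingNumber≤n∸2 {z} (_ , minimal) = begin
      z                       ≤⟨ minimal _ ∁⁅x,u⁆-zeroForcing ⟩
      ∣ ∁ (⁅ x ⁆ ∪ ⁅ u ⁆) ∣   ≡⟨ ∣∁p∣≡n∸∣p∣ (⁅ x ⁆ ∪ ⁅ u ⁆) ⟩
      n ∸ ∣ ⁅ x ⁆ ∪ ⁅ u ⁆ ∣   ≤⟨ ℕₚ.∸-monoʳ-≤ n two ⟩
      n ∸ 2                   ∎
      where
      open ℕₚ.≤-Reasoning
      two : 2 ≤ ∣ ⁅ x ⁆ ∪ ⁅ u ⁆ ∣
      two = two-elements⇒2≤∣p∣ (x∈p∪q⁺ (inj₁ (x∈⁅x⁆ x))) (x∈p∪q⁺ (inj₂ (x∈⁅x⁆ u))) (Adj⇒≢ G x~u)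

  zeroForcingNumber≤n∸1 : Connected G → 2 ≤ n → ∀ {z} → IsZeroForcingNumber G z → z ≤ n ∸ 1
  zeroForcingNumber≤n∸1 conn 2≤n {z} (_ , minimal) = begin
    z             ≤⟨ minimal _ (∁⁅w⁆-zeroForcing (proj₂ (connected⇒neighbour G conn 2≤n w))) ⟩
    ∣ ∁ ⁅ w ⁆ ∣   ≡⟨ ∣∁p∣≡n∸∣p∣ ⁅ w ⁆ ⟩
    n ∸ ∣ ⁅ w ⁆ ∣ ≡⟨ cong (n ∸_) (∣⁅x⁆∣≡1 w) ⟩
    n ∸ 1         ∎
    where
    open ℕₚ.≤-Reasoning
    w : Fin n
    w = Fin.fromℕ< 2≤n

module _ {k : ℕ} (H : Graph k) where

  CanForce : Subset k → Fin k → Fin k → Set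
  CanForce B u w = u ∈ B × w ∉ B × Adj H u w × (∀ x → Adj H u x → x ≢ w → x ∈ B)

  data ForcingChain (B : Subset k) : Set where
    finished : (∀ v → v ∈ B) → ForcingChain B
    forces   : ∀ {u w} → CanForce B u w → ForcingChain (B ∪ ⁅ w ⁆) → ForcingChain B

  forceAvailable : ∀ {S B w} → S ⊆ B → Black H S w → w ∉ B → ∃₂ (CanForce B)
  forceAvailable S⊆B (initial w∈S) w∉B = ⊥-elim (w∉B (S⊆B w∈S))
  forceAvailable {B = B} S⊆B (force {u} {w} black-u u~w others) w∉B with u ∈? B
  ... | no u∉B = forceAvailable S⊆B black-u u∉B
  ... | yes u∈B with Finₚ.any? (λ x → Adj? H u x ×-dec ¬? (x Finₚ.≟ w) ×-dec ¬? (x ∈? B))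
  ...   | yes (x , u~x , x≢w , x∉B) = forceAvailable S⊆B (others x u~x x≢w) x∉B
  ...   | no noOtherWhite = u , w , u∈B , w∉B , u~w , λ x u~x x≢w →
          decidable-stable (x ∈? B) (λ x∉B → noOtherWhite (x , u~x , x≢w , x∉B))

  forcingChain : ∀ {S} → ZeroForcingSet H S → ForcingChain S
  forcingChain {S} zf = go (λ x∈S → x∈S) (⊃-wellFounded S)
    where
    go : ∀ {B} → S ⊆ B → Acc _⊃_ B → ForcingChain B
    go {B} S⊆B (acc smaller) with Finₚ.all? (_∈? B)
    ... | yes full    = finished full
    ... | no notFull =
      let w , w∉B = Finₚ.¬∀⟶∃¬ k _ (_∈? B) notFull
          _ , w′ , cf@(_ , w′∉B , _) = forceAvailable S⊆B (zf w) w∉B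
      in forces cf (go (p⊆p∪q ⁅ w′ ⁆ ∘ S⊆B) (smaller (p⊂p∪⁅x⁆ w′∉B)))

  black⇒nonempty : ∀ {S v} → Black H S v → Nonempty S
  black⇒nonempty (initial v∈S)       = _ , v∈S
  black⇒nonempty (force black-u _ _) = black⇒nonempty black-u

module Edges {n : ℕ} (G : Graph n) where

  Edge : Set
  Edge = Fin (numEdges G)

  ends : Edge → Fin n × Fin n
  ends = lookup (edges G)

  infix 4 _∈ᵉ_ _∈ᵉ?_

  _∈ᵉ_ : Fin n → Edge → Set
  v ∈ᵉ i = v ≡ proj₁ (ends i) ⊎ v ≡ proj₂ (ends i)

  _∈ᵉ?_ : ∀ v i → Dec (v ∈ᵉ i)
  v ∈ᵉ? i = (v Finₚ.≟ proj₁ (ends i)) ⊎-dec (v Finₚ.≟ proj₂ (ends i))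

  private
    allVertices≡allFin : allVertices n ≡ List.allFin n
    allVertices≡allFin = toList∘tabulate (λ v → v)

    allPairs : List (Fin n × Fin n)
    allPairs = concatMap (λ u → map (u ,_) (allVertices n)) (allVertices n)

    allPairs≡ : allPairs ≡ cartesianProduct (List.allFin n) (List.allFin n)
    allPairs≡ = trans (concatMap-pairs≡cartesianProduct (allVertices n) (allVertices n))
                      (cong (λ vs → cartesianProduct vs vs) allVertices≡allFin)

    isOrderedEdge : Fin n × Fin n → Bool
    isOrderedEdge (a , b) = (toℕ a <ᵇ toℕ b) ∧ adj G a b

  edges-unique : Unique (edges G)
  edges-unique = Uniqueₚ.filter⁺ (T? ∘ isOrderedEdge) (subst Unique (sym allPairs≡)
    (Uniqueₚ.cartesianProduct⁺ (Uniqueₚ.allFin⁺ n) (Uniqueₚ.allFin⁺ n)))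

  ∈-edges⁺ : ∀ {a b} → toℕ a < toℕ b → Adj G a b → (a , b) ∈ₗ edges G
  ∈-edges⁺ a<b a~b = ∈ₗ.∈-filter⁺ (T? ∘ isOrderedEdge)
    (subst ((_ , _) ∈ₗ_) (sym allPairs≡)
      (∈ₗ.∈-cartesianProduct⁺ (∈ₗ.∈-allFin _) (∈ₗ.∈-allFin _)))
    (from T-∧ (ℕₚ.<⇒<ᵇ a<b , a~b))

  ∈-edges⁻ : ∀ {a b} → (a , b) ∈ₗ edges G → toℕ a < toℕ b × Adj G a b
  ∈-edges⁻ e∈ with to T-∧ (proj₂ (∈ₗ.∈-filter⁻ (T? ∘ isOrderedEdge) {xs = allPairs} e∈))
  ... | a<ᵇb , a~b = ℕₚ.<ᵇ⇒< _ _ a<ᵇb , a~b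

  ends-ordered : ∀ i → toℕ (proj₁ (ends i)) < toℕ (proj₂ (ends i))
  ends-ordered i = proj₁ (∈-edges⁻ (∈ₗ.∈-lookup i))

  ends-adjacent : ∀ i → Adj G (proj₁ (ends i)) (proj₂ (ends i))
  ends-adjacent i = proj₂ (∈-edges⁻ (∈ₗ.∈-lookup i))

  edgeIndex : ∀ {a b} → toℕ a < toℕ b → Adj G a b → ∃ λ i → ends i ≡ (a , b)
  edgeIndex a<b a~b = Any.index e∈ , sym (Anyₚ.lookup-index e∈)
    where e∈ = ∈-edges⁺ a<b a~b

  orderedEdges⇒≤numEdges : ∀ {l} (f : Fin l → Fin n × Fin n) → Injective _≡_ _≡_ f →
    (∀ i → toℕ (proj₁ (f i)) < toℕ (proj₂ (f i)) × Adj G (proj₁ (f i)) (proj₂ (f i))) →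
    l ≤ numEdges G
  orderedEdges⇒≤numEdges f f-injective isEdge = Finₚ.injective⇒≤ index-injective
    where
    index : ∀ i → ∃ λ e → ends e ≡ f i
    index i = edgeIndex (proj₁ (isEdge i)) (proj₂ (isEdge i))

    index-injective : Injective _≡_ _≡_ (proj₁ ∘ index)
    index-injective {i} {j} eq =
      f-injective (trans (sym (proj₂ (index i))) (trans (cong ends eq) (proj₂ (index j))))

  adjacent⇒edge : ∀ {a b} → Adj G a b → ∃ λ i → a ∈ᵉ i × b ∈ᵉ i
  adjacent⇒edge {a} {b} a~b with ℕₚ.<-cmp (toℕ a) (toℕ b)
  ... | tri< a<b _ _ = let i , eq = edgeIndex a<b a~b in
    i , inj₁ (cong proj₁ (sym eq)) , inj₂ (cong proj₂ (sym eq))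
  ... | tri≈ _ a≡b _ = ⊥-elim (Adj⇒≢ G a~b (Finₚ.toℕ-injective a≡b))
  ... | tri> _ _ b<a = let i , eq = edgeIndex b<a (Adj-sym G a~b) in
    i , inj₂ (cong proj₂ (sym eq)) , inj₁ (cong proj₁ (sym eq))

  incidentEdge : Connected G → 2 ≤ n → ∀ v → ∃ (v ∈ᵉ_)
  incidentEdge conn 2≤n v =
    let i , v∈i , _ = adjacent⇒edge (proj₂ (connected⇒neighbour G conn 2≤n v)) in i , v∈i

  ∈ᵉ-adjacent : ∀ {i a b} → a ∈ᵉ i → b ∈ᵉ i → a ≢ b → Adj G a b
  ∈ᵉ-adjacent (inj₁ refl) (inj₁ refl) a≢a = ⊥-elim (a≢a refl)
  ∈ᵉ-adjacent {i} (inj₁ refl) (inj₂ refl) _ = ends-adjacent i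
  ∈ᵉ-adjacent {i} (inj₂ refl) (inj₁ refl) _ = Adj-sym G (ends-adjacent i)
  ∈ᵉ-adjacent (inj₂ refl) (inj₂ refl) a≢a = ⊥-elim (a≢a refl)

  otherEnd : ∀ {i v} → v ∈ᵉ i → ∃ λ w → w ∈ᵉ i × w ≢ v × (∀ x → x ∈ᵉ i → x ≡ v ⊎ x ≡ w)
  otherEnd {i} (inj₁ refl) =
    proj₂ (ends i) , inj₂ refl , Adj⇒≢ G (Adj-sym G (ends-adjacent i)) , λ _ x∈i → x∈i
  otherEnd {i} (inj₂ refl) =
    proj₁ (ends i) , inj₁ refl , Adj⇒≢ G (ends-adjacent i) , λ _ → Sum.swap

  ends-sorted : ∀ {i p q} → p ∈ᵉ i → q ∈ᵉ i → toℕ p < toℕ q → ends i ≡ (p , q)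
  ends-sorted     (inj₁ refl) (inj₂ refl) _   = refl
  ends-sorted {i} (inj₂ refl) (inj₁ refl) q<p = ⊥-elim (ℕₚ.<-asym q<p (ends-ordered i))
  ends-sorted     (inj₁ refl) (inj₁ refl) p<p = ⊥-elim (ℕₚ.<-irrefl refl p<p)
  ends-sorted     (inj₂ refl) (inj₂ refl) p<p = ⊥-elim (ℕₚ.<-irrefl refl p<p)

  same-ends⇒same-edge : ∀ {i j p q} → p ≢ q → p ∈ᵉ i → q ∈ᵉ i → p ∈ᵉ j → q ∈ᵉ j → i ≡ j
  same-ends⇒same-edge {i} {j} {p} {q} p≢q p∈i q∈i p∈j q∈j with ℕₚ.<-cmp (toℕ p) (toℕ q)
  ... | tri< p<q _ _ = lookup-injective edges-unique i j
                         (trans (ends-sorted p∈i q∈i p<q) (sym (ends-sorted p∈j q∈j p<q)))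
  ... | tri≈ _ p≡q _ = ⊥-elim (p≢q (Finₚ.toℕ-injective p≡q))
  ... | tri> _ _ q<p = lookup-injective edges-unique i j
                         (trans (ends-sorted q∈i p∈i q<p) (sym (ends-sorted q∈j p∈j q<p)))

  L : Graph (numEdges G)
  L = LineGraph G

  private
    touches : Fin n → Fin n × Fin n → Bool
    touches v (c , d) = (toℕ v ≡ᵇ toℕ c) ∨ (toℕ v ≡ᵇ toℕ d)

    ≡ᵇ⇒≡ : ∀ {u w : Fin n} → T (toℕ u ≡ᵇ toℕ w) → u ≡ w
    ≡ᵇ⇒≡ = Finₚ.toℕ-injective ∘ ℕₚ.≡ᵇ⇒≡ _ _

    ≡⇒≡ᵇ : ∀ {u w : Fin n} → u ≡ w → T (toℕ u ≡ᵇ toℕ w)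
    ≡⇒≡ᵇ = ℕₚ.≡⇒≡ᵇ _ _ ∘ cong toℕ

    touches⁻ : ∀ v e → T (touches v e) → v ≡ proj₁ e ⊎ v ≡ proj₂ e
    touches⁻ v e = Sum.map ≡ᵇ⇒≡ ≡ᵇ⇒≡ ∘ to (T-∨ {toℕ v ≡ᵇ toℕ (proj₁ e)})

    touches⁺ : ∀ v e → v ≡ proj₁ e ⊎ v ≡ proj₂ e → T (touches v e)
    touches⁺ v e = from (T-∨ {toℕ v ≡ᵇ toℕ (proj₁ e)}) ∘ Sum.map ≡⇒≡ᵇ ≡⇒≡ᵇ

    share⁻ : ∀ e e′ → T (share e e′) →
      ∃ λ v → (v ≡ proj₁ e ⊎ v ≡ proj₂ e) × (v ≡ proj₁ e′ ⊎ v ≡ proj₂ e′)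
    share⁻ (a , b) e′ t with to (T-∨ {touches a e′}) t
    ... | inj₁ a∈e′ = a , inj₁ refl , touches⁻ a e′ a∈e′
    ... | inj₂ b∈e′ = b , inj₂ refl , touches⁻ b e′ b∈e′

    share⁺ : ∀ e e′ {v} → v ≡ proj₁ e ⊎ v ≡ proj₂ e → v ≡ proj₁ e′ ⊎ v ≡ proj₂ e′ →
      T (share e e′)
    share⁺ (a , b) e′ (inj₁ refl) v∈e′ = from (T-∨ {touches a e′}) (inj₁ (touches⁺ a e′ v∈e′))
    share⁺ (a , b) e′ (inj₂ refl) v∈e′ = from (T-∨ {touches a e′}) (inj₂ (touches⁺ b e′ v∈e′))

  lineAdj⁺ : ∀ {i j v} → i ≢ j → v ∈ᵉ i → v ∈ᵉ j → Adj L i j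
  lineAdj⁺ {i} {j} i≢j v∈i v∈j = from T-∧
    ( ≢⇒T-not-≡ᵇ i≢j
    , from (T-∨ {share (ends i) (ends j)}) (inj₁ (share⁺ (ends i) (ends j) v∈i v∈j)) )

  lineAdj⁻ : ∀ {i j} → Adj L i j → i ≢ j × ∃ λ v → v ∈ᵉ i × v ∈ᵉ j
  lineAdj⁻ {i} {j} i~j with to T-∧ i~j
  ... | distinct , shared =
    T-not-≡ᵇ⇒≢ distinct ,
    [ share⁻ (ends i) (ends j)
    , (λ (v , v∈j , v∈i) → v , v∈i , v∈j) ∘ share⁻ (ends j) (ends i)
    ]′ (to (T-∨ {share (ends i) (ends j)}) shared)

module LineGraphForcing {n : ℕ} (G : Graph n) where
  open Edges G

  Saturated : Subset (numEdges G) → Fin n → Set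
  Saturated B v = ∀ i → v ∈ᵉ i → i ∈ B

  WhiteEdgeAt : Subset (numEdges G) → Fin n → Set
  WhiteEdgeAt B v = ∃ λ i → v ∈ᵉ i × i ∉ B

  whiteEdgeAt? : ∀ B → Decidable (WhiteEdgeAt B)
  whiteEdgeAt? B v = Finₚ.any? (λ i → v ∈ᵉ? i ×-dec ¬? (i ∈? B))

  unsaturated : Subset (numEdges G) → Subset n
  unsaturated B = subsetOf (whiteEdgeAt? B)

  ∈-unsaturated⁺ : ∀ {B i v} → v ∈ᵉ i → i ∉ B → v ∈ unsaturated B
  ∈-unsaturated⁺ {B} v∈i i∉B = ∈-subsetOf⁺ (whiteEdgeAt? B) (_ , v∈i , i∉B)

  saturated⇒∉unsaturated : ∀ {B v} → Saturated B v → v ∉ unsaturated B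
  saturated⇒∉unsaturated {B} sat v∈ with ∈-subsetOf⁻ (whiteEdgeAt? B) v∈
  ... | i , v∈i , i∉B = i∉B (sat i v∈i)

  edgesAtEndpoint : ∀ {ℓ} (P : Edge → Set ℓ) {e f p} → p ∈ᵉ e → P e →
    (∀ x → Adj L e x → x ≢ f → P x) → ∀ j → p ∈ᵉ j → j ≢ f → P j
  edgesAtEndpoint P {e} p∈e Pe others j p∈j j≢f with j Finₚ.≟ e
  ... | yes refl = Pe
  ... | no  j≢e  = others j (lineAdj⁺ (j≢e ∘ sym) p∈e p∈j) j≢f

  module ForceStep {B e f} (cf : CanForce L B e f) where
    private
      e∈B = proj₁ cf
      f∉B = proj₁ (proj₂ cf)
      e~f = proj₁ (proj₂ (proj₂ cf))
      others = proj₂ (proj₂ (proj₂ cf))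

    pivot : Fin n
    pivot = proj₁ (proj₂ (lineAdj⁻ e~f))

    pivot∈e : pivot ∈ᵉ e
    pivot∈e = proj₁ (proj₂ (proj₂ (lineAdj⁻ e~f)))

    pivot∈f : pivot ∈ᵉ f
    pivot∈f = proj₂ (proj₂ (proj₂ (lineAdj⁻ e~f)))

    pivot-saturated : Saturated (B ∪ ⁅ f ⁆) pivot
    pivot-saturated j p∈j with j Finₚ.≟ f
    ... | yes refl = x∈p∪q⁺ (inj₂ (x∈⁅x⁆ f))
    ... | no  j≢f  = p⊆p∪q ⁅ f ⁆ (edgesAtEndpoint (_∈ B) pivot∈e e∈B others j p∈j j≢f)

    farEnd : Fin n
    farEnd = proj₁ (otherEnd pivot∈e)

    farEnd∈e : farEnd ∈ᵉ e
    farEnd∈e = proj₁ (proj₂ (otherEnd pivot∈e))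

    farEnd≢pivot : farEnd ≢ pivot
    farEnd≢pivot = proj₁ (proj₂ (proj₂ (otherEnd pivot∈e)))

    farEnd-saturated : Saturated B farEnd
    farEnd-saturated j q∈j with j Finₚ.≟ f
    ... | no  j≢f  = edgesAtEndpoint (_∈ B) farEnd∈e e∈B others j q∈j j≢f
    ... | yes refl = ⊥-elim (f∉B (subst (_∈ B) e≡f e∈B))
      where e≡f = same-ends⇒same-edge farEnd≢pivot farEnd∈e pivot∈e q∈j pivot∈f

    unsaturated-shrinks : ∣ unsaturated (B ∪ ⁅ f ⁆) ∣ < ∣ unsaturated B ∣
    unsaturated-shrinks = p⊂q⇒∣p∣<∣q∣
      ( shrinks , pivot , ∈-unsaturated⁺ pivot∈f f∉B , saturated⇒∉unsaturated pivot-saturated )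
      where
      shrinks : unsaturated (B ∪ ⁅ f ⁆) ⊆ unsaturated B
      shrinks v∈ with ∈-subsetOf⁻ (whiteEdgeAt? (B ∪ ⁅ f ⁆)) v∈
      ... | i , v∈i , i∉B′ = ∈-unsaturated⁺ v∈i (i∉B′ ∘ p⊆p∪q ⁅ f ⁆)

  potential-bound : ∀ {B e f} → CanForce L B e f → ForcingChain L (B ∪ ⁅ f ⁆) →
    ℕ.suc (numEdges G) ≤ ∣ B ∣ + ∣ unsaturated B ∣
  potential-bound {B} {f = f} (_ , f∉B , _) (finished full) = begin
    ℕ.suc (numEdges G)         ≤⟨ s≤s (full⇒n≤∣p∣ full) ⟩
    ℕ.suc ∣ B ∪ ⁅ f ⁆ ∣        ≤⟨ s≤s (∣p∪⁅x⁆∣≤1+∣p∣ B f) ⟩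
    2 + ∣ B ∣                  ≡⟨ ℕₚ.+-comm 2 ∣ B ∣ ⟩
    ∣ B ∣ + 2                  ≤⟨ ℕₚ.+-monoʳ-≤ ∣ B ∣ bothEndsUnsaturated ⟩
    ∣ B ∣ + ∣ unsaturated B ∣  ∎
    where
    open ℕₚ.≤-Reasoning
    bothEndsUnsaturated : 2 ≤ ∣ unsaturated B ∣
    bothEndsUnsaturated = two-elements⇒2≤∣p∣ (∈-unsaturated⁺ (inj₁ refl) f∉B)
      (∈-unsaturated⁺ (inj₂ refl) f∉B) (Adj⇒≢ G (ends-adjacent f))
  potential-bound {B} {f = f} cf (forces cf′ chain) = begin
    ℕ.suc (numEdges G)                           ≤⟨ potential-bound cf′ chain ⟩
    ∣ B ∪ ⁅ f ⁆ ∣ + ∣ unsaturated (B ∪ ⁅ f ⁆) ∣  ≤⟨ ℕₚ.+-monoˡ-≤ _ (∣p∪⁅x⁆∣≤1+∣p∣ B f) ⟩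
    ℕ.suc ∣ B ∣ + ∣ unsaturated (B ∪ ⁅ f ⁆) ∣    ≡⟨ ℕₚ.+-suc ∣ B ∣ _ ⟨
    ∣ B ∣ + ℕ.suc ∣ unsaturated (B ∪ ⁅ f ⁆) ∣    ≤⟨ ℕₚ.+-monoʳ-≤ ∣ B ∣ unsaturated-shrinks ⟩
    ∣ B ∣ + ∣ unsaturated B ∣                    ∎
    where
    open ℕₚ.≤-Reasoning
    open ForceStep cf

  lineGraph-zeroForcing-lowerBound : 2 ≤ n → ∀ {S} → ZeroForcingSet L S →
    2 + numEdges G ≤ n + ∣ S ∣
  lineGraph-zeroForcing-lowerBound 2≤n {S} zf with forcingChain L zf
  ... | finished full = ℕₚ.+-mono-≤ 2≤n (full⇒n≤∣p∣ full)
  ... | forces cf chain = begin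
    2 + numEdges G                      ≤⟨ s≤s (potential-bound cf chain) ⟩
    ℕ.suc (∣ S ∣ + ∣ unsaturated S ∣)    ≡⟨ ℕₚ.+-suc ∣ S ∣ _ ⟨
    ∣ S ∣ + ℕ.suc ∣ unsaturated S ∣      ≤⟨ ℕₚ.+-monoʳ-≤ ∣ S ∣ unsaturated<n ⟩
    ∣ S ∣ + n                           ≡⟨ ℕₚ.+-comm ∣ S ∣ n ⟩
    n + ∣ S ∣                           ∎
    where
    open ℕₚ.≤-Reasoning
    open ForceStep cf
    unsaturated<n : ∣ unsaturated S ∣ < n
    unsaturated<n = subst (∣ unsaturated S ∣ <_) (∣⊤∣≡n n)
      (p⊂q⇒∣p∣<∣q∣ (⊆⊤ , farEnd , ∈⊤ , saturated⇒∉unsaturated farEnd-saturated))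

  leafEndpoint : ∀ {e} → ZeroForcingSet L ⁅ e ⁆ → ∃ λ q → q ∈ᵉ e × Saturated ⁅ e ⁆ q
  leafEndpoint {e} zf with forcingChain L zf
  ... | finished full = proj₁ (ends e) , inj₁ refl , λ i _ → full i
  ... | forces cf@(forcer∈⁅e⁆ , _) _ with x∈⁅y⁆⇒x≡y e forcer∈⁅e⁆
  ...   | refl = farEnd , farEnd∈e , farEnd-saturated
    where open ForceStep cf

  module _ {R : Subset n} where

    EndsBlack : Edge → Set
    EndsBlack i = ∀ v → v ∈ᵉ i → Black G R v

    blackEndpoints : ∀ {S f} → (∀ i → i ∈ S → EndsBlack i) → Black L S f → EndsBlack f
    blackEndpoints initiallyBlack (initial f∈S) = initiallyBlack _ f∈S
    blackEndpoints initiallyBlack (force {e} {f} black-e e~f others) v v∈f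
      with proj₂ (lineAdj⁻ e~f)
    ... | p , p∈e , p∈f with otherEnd p∈f
    ...   | r , r∈f , r≢p , ends-f =
      [ (λ { refl → black-p }) , (λ { refl → black-r }) ]′ (ends-f v v∈f)
      where
      ends-e : EndsBlack e
      ends-e = blackEndpoints initiallyBlack black-e

      black-p : Black G R p
      black-p = ends-e p p∈e

      black-r : Black G R r
      black-r = force black-p (∈ᵉ-adjacent p∈f r∈f (r≢p ∘ sym)) λ x p~x x≢r →
        let j , p∈j , x∈j = adjacent⇒edge p~x
            j≢f : j ≢ f
            j≢f = λ { refl → [ (λ x≡p → Adj⇒≢ G p~x (sym x≡p)) , x≢r ]′ (ends-f x x∈j) }
        in edgesAtEndpoint EndsBlack p∈e ends-e
             (λ i e~i i≢f → blackEndpoints initiallyBlack (others i e~i i≢f)) j p∈j j≢f x x∈j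

  singleton-zeroForcing : Connected G → 2 ≤ n → ∀ {e} → ZeroForcingSet L ⁅ e ⁆ →
    ∃ λ q → ZeroForcingSet G ⁅ q ⁆
  singleton-zeroForcing conn 2≤n {e} zf with leafEndpoint zf
  ... | q , q∈e , q-leaf with otherEnd q∈e
  ...   | r , r∈e , r≢q , ends-e = q , λ v →
    let i , v∈i = incidentEdge conn 2≤n v in blackEndpoints endsOfE (zf i) v v∈i
    where
    black-r : Black G ⁅ q ⁆ r
    black-r = force (initial (x∈⁅x⁆ q)) (∈ᵉ-adjacent q∈e r∈e (r≢q ∘ sym)) λ x q~x x≢r →
      let j , q∈j , x∈j = adjacent⇒edge q~x
          x∈e = subst (x ∈ᵉ_) (x∈⁅y⁆⇒x≡y e (q-leaf j q∈j)) x∈j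
      in ⊥-elim ([ (λ x≡q → Adj⇒≢ G q~x (sym x≡q)) , x≢r ]′ (ends-e x x∈e))

    endsOfE : ∀ i → i ∈ ⁅ e ⁆ → EndsBlack {⁅ q ⁆} i
    endsOfE i i∈⁅e⁆ v v∈i with x∈⁅y⁆⇒x≡y e i∈⁅e⁆
    ... | refl = [ (λ { refl → initial (x∈⁅x⁆ q) }) , (λ { refl → black-r }) ]′ (ends-e v v∈i)

  lineGraph-zeroForcing≤1 : Connected G → 2 ≤ n → ∀ {S} → ZeroForcingSet L S → ∣ S ∣ ≤ 1 →
    ∃ λ R → ZeroForcingSet G R × ∣ R ∣ ≤ ∣ S ∣
  lineGraph-zeroForcing≤1 conn 2≤n {S} zf ∣S∣≤1
    with black⇒nonempty L (zf (proj₁ (incidentEdge conn 2≤n (Fin.fromℕ< 2≤n))))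
  ... | e , e∈S with ∣p∣≤1⇒p≡⁅x⁆ e∈S ∣S∣≤1
  ...   | refl = let q , zf-q = singleton-zeroForcing conn 2≤n zf in
                 ⁅ q ⁆ , zf-q , ℕₚ.≤-reflexive (trans (∣⁅x⁆∣≡1 q) (sym (∣⁅x⁆∣≡1 e)))

complete⇒numEdges : ∀ {k} (G : Graph (2 + k)) → (∀ a b → a ≢ b → Adj G a b) →
  k + ℕ.suc k ≤ numEdges G
complete⇒numEdges {k} G complete = Edges.orderedEdges⇒≤numEdges G (pair ∘ Fin.splitAt k)
  (Injection.injective (↔⇒↣ (Finₚ.+↔⊎ {k})) ∘ pair-injective)
  (isEdge ∘ Fin.splitAt k)
  where
  pair : Fin k ⊎ Fin (ℕ.suc k) → Fin (2 + k) × Fin (2 + k)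
  pair (inj₁ j) = suc zero , suc (suc j)
  pair (inj₂ j) = zero , suc j

  pair-injective : Injective _≡_ _≡_ pair
  pair-injective {inj₁ _} {inj₁ _} refl = refl
  pair-injective {inj₂ _} {inj₂ _} refl = refl

  isEdge : ∀ x → toℕ (proj₁ (pair x)) < toℕ (proj₂ (pair x)) ×
                 Adj G (proj₁ (pair x)) (proj₂ (pair x))
  isEdge (inj₁ _) = s≤s (s≤s z≤n) , complete _ _ λ ()
  isEdge (inj₂ _) = s≤s z≤n , complete _ _ λ ()

open LineGraphForcing using (lineGraph-zeroForcing-lowerBound; lineGraph-zeroForcing≤1)

proposition3p15 : ∀ (n : ℕ) (G : Graph n) → 2 ≤ n → Connected G →
    (n ≤ 4 ⊎ (HamiltonianPath G × 2 * (n ∸ 2) ≤ numEdges G)) →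
    ∀ (z zL : ℕ) → IsZeroForcingNumber G z →
    IsZeroForcingNumber (LineGraph G) zL → z ≤ zL
proposition3p15 (ℕ.suc (ℕ.suc k)) G 2≤n@(s≤s (s≤s z≤n)) conn hyp z _
                isZ@(_ , z-minimal) ((S , zf-S , refl) , _)
  with ℕₚ.≤-pred (ℕₚ.≤-pred (lineGraph-zeroForcing-lowerBound G 2≤n zf-S))
     | complete⊎inducedPath₃ G conn
... | m≤k+∣S∣ | inj₁ complete = ℕₚ.+-cancelˡ-≤ k z ∣ S ∣ (begin
  k + z           ≤⟨ ℕₚ.+-monoʳ-≤ k (zeroForcingNumber≤n∸1 G conn 2≤n isZ) ⟩
  k + ℕ.suc k     ≤⟨ complete⇒numEdges G complete ⟩
  numEdges G      ≤⟨ m≤k+∣S∣ ⟩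
  k + ∣ S ∣       ∎)
  where open ℕₚ.≤-Reasoning
... | m≤k+∣S∣ | inj₂ P with hyp
...   | inj₂ (_ , 2k≤m) = ℕₚ.≤-trans (zeroForcingNumber≤n∸2 G P isZ)
  (subst (_≤ ∣ S ∣) (ℕₚ.+-identityʳ k) (ℕₚ.+-cancelˡ-≤ k (k + 0) ∣ S ∣ (ℕₚ.≤-trans 2k≤m m≤k+∣S∣)))
...   | inj₁ n≤4 with ∣ S ∣ ℕ.≤? 1
...     | yes ∣S∣≤1 =
  let R , zf-R , ∣R∣≤∣S∣ = lineGraph-zeroForcing≤1 G conn 2≤n zf-S ∣S∣≤1 in
  ℕₚ.≤-trans (z-minimal R zf-R) ∣R∣≤∣S∣
...     | no  ∣S∣≰1 = ℕₚ.≤-trans (zeroForcingNumber≤n∸2 G P isZ)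
  (ℕₚ.≤-trans (ℕₚ.≤-pred (ℕₚ.≤-pred n≤4)) (ℕₚ.≰⇒> ∣S∣≰1))
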